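{- Let $L$ be a finite geometric lattice of rank $r$ with the minimal labeling $\lambda$ induced by some total ordering of its atoms, and let $(\lambda_1,\dots,\lambda_r)$ be the label sequence of the unique maximal chain of $L$ whose label sequence is weakly increasing. Then for every permutation $\sigma\in S_r$, the sequence $(\lambda_{\sigma(1)},\dots,\lambda_{\sigma(r)})$ is the label sequence of some maximal chain of $L$.
   Context: A finite lattice is geometric if it is atomic and semimodular; it is graded. For $u\in L$ let $A(u)$ be the set of atoms below $u$. The minimal labeling induced by a total order on atoms assigns to $u\lessdot v$ the label $\lambda(u,v)=\min(A(v)\setminus A(u))$. It is known to be an EL-labeling, so there is a unique maximal chain (the ascending chain) whose label sequence is weakly increasing. -}

module Defs where

open import Data.Nat as ℕ using (ℕ; suc)
open import Data.Fin as Fin using (Fin; inject₁; fromℕ)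
open import Data.Fin.Permutation using (Permutation′; _⟨$⟩ʳ_)
open import Data.List using (List; foldr)
open import Data.List.Relation.Unary.All using (All)
open import Data.Product using (Σ; ∃; _×_)
open import Relation.Binary.PropositionalEquality using (_≡_; _≢_)
open import Relation.Binary.Lattice.Structures using (IsBoundedLattice)
open import Relation.Nullary using (¬_)

-- A finite lattice, represented (up to isomorphism) on the carrier Fin n,
-- with propositional equality, a partial order _≤_, join, meet, top and bottom.
record FiniteLattice : Set₁ where
  field
    n     : ℕ
    _≤_   : Fin n → Fin n → Set
    _∨_   : Fin n → Fin n → Fin n
    _∧_   : Fin n → Fin n → Fin n
    ⊤     : Fin n
    ⊥     : Fin n
    isBoundedLattice : IsBoundedLattice _≡_ _≤_ _∨_ _∧_ ⊤ ⊥

  Carrier : Set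
  Carrier = Fin n

  _<_ : Carrier → Carrier → Set
  x < y = x ≤ y × x ≢ y

  _⋖_ : Carrier → Carrier → Set
  x ⋖ y = x < y × (∀ z → x < z → z ≤ y → z ≡ y)

  IsAtom : Carrier → Set
  IsAtom a = ⊥ ⋖ a

  ⋁ : List Carrier → Carrier
  ⋁ = foldr _∨_ ⊥

  Atomic : Set
  Atomic = ∀ x → Σ (List Carrier) λ as → All IsAtom as × x ≡ ⋁ as

  Semimodular : Set
  Semimodular = ∀ x y → (x ∧ y) ⋖ x → (x ∧ y) ⋖ y → (x ⋖ (x ∨ y)) × (y ⋖ (x ∨ y))

  Geometric : Set
  Geometric = Atomic × Semimodular

  record MaximalChain (k : ℕ) : Set where
    field
      pt     : Fin (suc k) → Carrier
      bottom : pt Fin.zero ≡ ⊥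
      top    : pt (fromℕ k) ≡ ⊤
      covers : ∀ (i : Fin k) → pt (inject₁ i) ⋖ pt (Fin.suc i)

  HasRank : ℕ → Set
  HasRank r = MaximalChain r × (∀ k → MaximalChain k → k ≡ r)

  -- A total order on the atoms, given by a key function injective on atoms
  -- (atom a precedes atom b iff key a < key b).
  AtomOrder : (Carrier → ℕ) → Set
  AtomOrder key = ∀ a b → IsAtom a → IsAtom b → key a ≡ key b → a ≡ b

  -- minimal labeling: λ(u,v) = min (A(v) ∖ A(u)) w.r.t. the atom order;
  -- IsMinLabel key u v a  means  a = λ(u,v)
  IsMinLabel : (Carrier → ℕ) → Carrier → Carrier → Carrier → Set
  IsMinLabel key u v a =
    (IsAtom a × a ≤ v × ¬ (a ≤ u)) ×
    (∀ b → IsAtom b → b ≤ v → ¬ (b ≤ u) → key a ℕ.≤ key b)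

  HasLabels : (Carrier → ℕ) → ∀ {k} → MaximalChain k → (Fin k → Carrier) → Set
  HasLabels key {k} c ℓ = ∀ (i : Fin k) →
    IsMinLabel key (MaximalChain.pt c (inject₁ i)) (MaximalChain.pt c (Fin.suc i)) (ℓ i)

  WeaklyIncreasing : (Carrier → ℕ) → ∀ {k} → (Fin k → Carrier) → Set
  WeaklyIncreasing key {k} ℓ = ∀ (i j : Fin k) → i Fin.≤ j → key (ℓ i) ℕ.≤ key (ℓ j)

-- Let a₁, …, a_r be the labels of the ascending chain c, so that c_i = a_i ∨ c_{i-1}. The a_i join
-- to ⊤, and reaching ⊤ takes at least r atoms in a semimodular lattice of rank r, so the a_i are
-- independent: no a_m lies below the join of the others. By semimodularity, adjoining
-- a_{σ 1}, a_{σ 2}, … one at a time therefore climbs a maximal chain, adding a_{σ i} at step i.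
-- That a_m (m = σ i) is the minimal label of its step u ⋖ v comes from the ascending chain: an atom
-- b ≤ v with b ≰ u and smaller key than a_m must lie below c_{m-1}, a join of labels other than a_m;
-- then v = b ∨ u lies below that join as well, although a_m ≤ v.
module Submission where

open import Defs
open import Data.Nat using (ℕ)
open import Data.Fin using (Fin)
open import Data.Fin.Permutation using (Permutation′; _⟨$⟩ʳ_)
open import Data.Product using (Σ; _×_)

open import Level using (0ℓ)
open import Function using (_∘_)
open import Data.Nat as ℕ using (suc; z≤n; s≤s)
import Data.Nat.Properties as ℕₚ
open import Data.Fin as Fin using (zero; suc; inject₁; fromℕ; toℕ; lower₁)
import Data.Fin.Properties as Finₚ
open import Data.Fin.Induction using (<-weakInduction)
open import Data.Fin.Permutation using (_⟨$⟩ˡ_; inverseˡ; inverseʳ)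
open import Data.List using (List; []; _∷_; map; filter; length; allFin)
open import Data.List.Relation.Unary.All using (All; []; _∷_; universal)
open import Data.List.Relation.Unary.All.Properties using (map⁺)
open import Data.List.Relation.Unary.Any using (here; there)
import Data.List.Relation.Unary.Any as Any
open import Data.List.Membership.Propositional using (_∈_)
open import Data.List.Membership.Propositional.Properties using (∈-map⁺; ∈-filter⁺; ∈-allFin)
import Data.List.Properties as Listₚ
open import Data.Product using (_,_; proj₁; proj₂)
open import Relation.Nullary using (¬_; Dec; yes; no; ¬?; contradiction)
open import Relation.Binary.PropositionalEquality
open import Relation.Binary.Lattice.Bundles using (BoundedLattice)
import Relation.Binary.Lattice.Properties.JoinSemilattice as JoinSemilatticeProperties
import Relation.Binary.Lattice.Properties.BoundedJoinSemilattice as BoundedJoinSemilatticeProperties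

module _ {a} {A : Set a} where

  prefix : ∀ {k} → (Fin k → A) → Fin (suc k) → List A
  prefix g zero = []
  prefix {suc k} g (suc i) = g i ∷ prefix (g ∘ inject₁) i

  prefix-inject₁ : ∀ {k} (g : Fin (suc k) → A) (i : Fin (suc k)) →
                   prefix (g ∘ inject₁) i ≡ prefix g (inject₁ i)
  prefix-inject₁ g zero = refl
  prefix-inject₁ {suc k} g (suc i) = cong (g (inject₁ i) ∷_) (prefix-inject₁ (g ∘ inject₁) i)

  prefix-suc : ∀ {k} (g : Fin k → A) (i : Fin k) → prefix g (suc i) ≡ g i ∷ prefix g (inject₁ i)
  prefix-suc {suc k} g i = cong (g i ∷_) (prefix-inject₁ g i)

  All-prefix : ∀ {p} {P : A → Set p} {k} (g : Fin k → A) (i : Fin (suc k)) →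
               (∀ t → t Fin.< i → P (g t)) → All P (prefix g i)
  All-prefix g zero h = []
  All-prefix {k = suc k} g (suc i) h =
    h i ℕₚ.≤-refl ∷ All-prefix (g ∘ inject₁) i λ t t<i →
      h (inject₁ t) (s≤s (ℕₚ.<⇒≤ (subst (ℕ._< toℕ i) (sym (Finₚ.toℕ-inject₁ t)) t<i)))

  ∈-prefix-suc : ∀ {k} (g : Fin k → A) (i : Fin k) → g i ∈ prefix g (suc i)
  ∈-prefix-suc g i = subst (g i ∈_) (sym (prefix-suc g i)) (here refl)

  ∈-prefix-fromℕ : ∀ {k} (g : Fin k → A) (t : Fin k) → g t ∈ prefix g (fromℕ k)
  ∈-prefix-fromℕ {suc k} g t with k ℕₚ.≟ toℕ t
  ... | yes k≡t = here (cong g (Finₚ.toℕ-injective (trans (sym k≡t) (sym (Finₚ.toℕ-fromℕ k)))))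
  ... | no k≢t = there (subst (λ s → g s ∈ prefix (g ∘ inject₁) (fromℕ k))
                         (Finₚ.inject₁-lower₁ t k≢t) (∈-prefix-fromℕ (g ∘ inject₁) (lower₁ t k≢t)))

module Lattice (L : FiniteLattice) where
  open FiniteLattice L

  boundedLattice : BoundedLattice 0ℓ 0ℓ 0ℓ
  boundedLattice = record { isBoundedLattice = isBoundedLattice }

  open BoundedLattice boundedLattice public
    using (maximum; minimum; x≤x∨y; y≤x∨y; ∨-least; x∧y≤x; x∧y≤y; ∧-greatest)
    renaming (refl to ≤-refl; trans to ≤-trans; antisym to ≤-antisym)
  open JoinSemilatticeProperties (BoundedLattice.joinSemilattice boundedLattice) public
    using (x≤y⇒x∨y≈y; ≈-dec⇒≤-dec)
  open BoundedJoinSemilatticeProperties (BoundedLattice.boundedJoinSemilattice boundedLattice) public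
    using (identityʳ)

  _≤?_ : ∀ x y → Dec (x ≤ y)
  _≤?_ = ≈-dec⇒≤-dec Fin._≟_

  ⋖-tight : ∀ {x y z} → x ⋖ y → x ≤ z → x ≢ z → z ≤ y → z ≡ y
  ⋖-tight (_ , tight) x≤z x≢z = tight _ (x≤z , x≢z)

  ⋖⇒≡∨ : ∀ {x y a} → x ⋖ y → a ≤ y → ¬ a ≤ x → y ≡ a ∨ x
  ⋖⇒≡∨ {x} {y} {a} x⋖y a≤y a≰x =
    sym (⋖-tight x⋖y (y≤x∨y a x) x≢a∨x (∨-least a≤y (proj₁ (proj₁ x⋖y))))
    where
    x≢a∨x : x ≢ a ∨ x
    x≢a∨x x≡a∨x = a≰x (subst (a ≤_) (sym x≡a∨x) (x≤x∨y a x))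

  x≤y⇒y∨[a∨x]≡a∨y : ∀ {x y} a → x ≤ y → y ∨ (a ∨ x) ≡ a ∨ y
  x≤y⇒y∨[a∨x]≡a∨y {x} {y} a x≤y = ≤-antisym
    (∨-least (y≤x∨y a y) (∨-least (x≤x∨y a y) (≤-trans x≤y (y≤x∨y a y))))
    (∨-least (≤-trans (x≤x∨y a x) (y≤x∨y y _)) (x≤x∨y y _))

  ⋁-upper : ∀ {a as} → a ∈ as → a ≤ ⋁ as
  ⋁-upper {as = b ∷ as} (here refl) = x≤x∨y b (⋁ as)
  ⋁-upper {as = b ∷ as} (there a∈as) = ≤-trans (⋁-upper a∈as) (y≤x∨y b (⋁ as))

  ⋁-least : ∀ {X as} → All (_≤ X) as → ⋁ as ≤ X
  ⋁-least [] = minimum _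
  ⋁-least (a≤X ∷ as≤X) = ∨-least a≤X (⋁-least as≤X)

  data Chain : Carrier → Carrier → ℕ → Set where
    [] : ∀ {x} → Chain x x 0
    _∷_ : ∀ {x y z k} → x ⋖ y → Chain y z k → Chain x z (suc k)

  _∷ʳ_ : ∀ {x y z k} → Chain x y k → y ⋖ z → Chain x z (suc k)
  [] ∷ʳ y⋖z = y⋖z ∷ []
  (x⋖w ∷ ch) ∷ʳ y⋖z = x⋖w ∷ (ch ∷ʳ y⋖z)

  point : ∀ {x y k} → Chain x y k → Fin (suc k) → Carrier
  point {x} ch zero = x
  point (_ ∷ ch) (suc i) = point ch i

  point-fromℕ : ∀ {x y k} (ch : Chain x y k) → point ch (fromℕ k) ≡ y
  point-fromℕ [] = refl
  point-fromℕ (_ ∷ ch) = point-fromℕ ch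

  point-⋖ : ∀ {x y k} (ch : Chain x y k) (i : Fin k) → point ch (inject₁ i) ⋖ point ch (suc i)
  point-⋖ (x⋖y ∷ ch) zero = x⋖y
  point-⋖ (x⋖y ∷ ch) (suc i) = point-⋖ ch i

  chain⇒maximalChain : ∀ {k} → Chain ⊥ ⊤ k → MaximalChain k
  chain⇒maximalChain ch = record
    { pt = point ch ; bottom = refl ; top = point-fromℕ ch ; covers = point-⋖ ch }

module Semimodularity (L : FiniteLattice) (semimodular : FiniteLattice.Semimodular L) where
  open FiniteLattice L
  open Lattice L

  ⋖-⋖⇒⋖-∨ : ∀ {x y z} → x ⋖ y → x ⋖ z → y ≢ z → y ⋖ (y ∨ z)
  ⋖-⋖⇒⋖-∨ {x} {y} {z} x⋖y x⋖z y≢z with (y ∧ z) Fin.≟ x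
  ... | yes y∧z≡x =
    proj₁ (semimodular y z (subst (_⋖ y) (sym y∧z≡x) x⋖y) (subst (_⋖ z) (sym y∧z≡x) x⋖z))
  ... | no y∧z≢x = contradiction (⋖-tight x⋖z x≤y x≢y y≤z) y≢z
    where
    x≤y : x ≤ y
    x≤y = proj₁ (proj₁ x⋖y)
    x≢y : x ≢ y
    x≢y = proj₂ (proj₁ x⋖y)
    y∧z≡y : y ∧ z ≡ y
    y∧z≡y = ⋖-tight x⋖y (∧-greatest x≤y (proj₁ (proj₁ x⋖z))) (y∧z≢x ∘ sym) (x∧y≤x y z)
    y≤z : y ≤ z
    y≤z = subst (_≤ z) y∧z≡y (x∧y≤y y z)

  ⋁-⋖ : ∀ {a as} → All IsAtom as → IsAtom a → ¬ a ≤ ⋁ as → ⋁ as ⋖ ⋁ (a ∷ as)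
  ⋁-⋖ {a} [] a-atom _ = subst (⊥ ⋖_) (sym (identityʳ a)) a-atom
  ⋁-⋖ {a} {b ∷ as} (b-atom ∷ atoms) a-atom a≰b∨x with b ≤? ⋁ as
  ... | yes b≤x = subst (λ w → w ⋖ (a ∨ w)) (sym (x≤y⇒x∨y≈y b≤x))
                    (⋁-⋖ atoms a-atom (a≰b∨x ∘ subst (a ≤_) (sym (x≤y⇒x∨y≈y b≤x))))
  ... | no b≰x =
    subst ((b ∨ x) ⋖_) (x≤y⇒y∨[a∨x]≡a∨y a (y≤x∨y b x)) (⋖-⋖⇒⋖-∨ x⋖b∨x x⋖a∨x b∨x≢a∨x)
    where
    x = ⋁ as
    x⋖b∨x : x ⋖ (b ∨ x)
    x⋖b∨x = ⋁-⋖ atoms b-atom b≰x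
    x⋖a∨x : x ⋖ (a ∨ x)
    x⋖a∨x = ⋁-⋖ atoms a-atom (a≰b∨x ∘ λ a≤x → ≤-trans a≤x (y≤x∨y b x))
    b∨x≢a∨x : b ∨ x ≢ a ∨ x
    b∨x≢a∨x b∨x≡a∨x = a≰b∨x (subst (a ≤_) (sym b∨x≡a∨x) (x≤x∨y a x))

  chain-to-⋁ : ∀ {as} → All IsAtom as → Σ ℕ λ k → k ℕ.≤ length as × Chain ⊥ (⋁ as) k
  chain-to-⋁ [] = 0 , z≤n , []
  chain-to-⋁ {b ∷ as} (b-atom ∷ atoms) with chain-to-⋁ atoms | b ≤? ⋁ as
  ... | k , k≤n , ch | yes b≤x =
    k , ℕₚ.m≤n⇒m≤1+n k≤n , subst (λ w → Chain ⊥ w k) (sym (x≤y⇒x∨y≈y b≤x)) ch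
  ... | k , k≤n , ch | no b≰x = suc k , s≤s k≤n , ch ∷ʳ ⋁-⋖ atoms b-atom b≰x

  rank≤length : ∀ {r} → HasRank r → ∀ {as} → All IsAtom as → ⋁ as ≡ ⊤ → r ℕ.≤ length as
  rank≤length (_ , unique) atoms ⋁as≡⊤ with chain-to-⋁ atoms
  ... | k , k≤n , ch =
    subst (ℕ._≤ _) (unique k (chain⇒maximalChain (subst (λ w → Chain ⊥ w k) ⋁as≡⊤ ch))) k≤n

  prefixChain : ∀ {k} (g : Fin k → Carrier) → (∀ t → IsAtom (g t)) →
                (∀ i → ¬ g i ≤ ⋁ (prefix g (inject₁ i))) → ⋁ (prefix g (fromℕ k)) ≡ ⊤ →
                MaximalChain k
  prefixChain g atoms independent spanning = record
    { pt = ⋁ ∘ prefix g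
    ; bottom = refl
    ; top = spanning
    ; covers = λ i → subst (λ as → ⋁ (prefix g (inject₁ i)) ⋖ ⋁ as) (sym (prefix-suc g i))
                       (⋁-⋖ (All-prefix g (inject₁ i) (λ t _ → atoms t)) (atoms i) (independent i))
    }

module LabelledChain (L : FiniteLattice) (key : FiniteLattice.Carrier L → ℕ) {k}
  (c : FiniteLattice.MaximalChain L k) {ℓ : Fin k → FiniteLattice.Carrier L}
  (labels : FiniteLattice.HasLabels L key c ℓ) where
  open FiniteLattice L
  open MaximalChain c
  open Lattice L

  label-atom : ∀ i → IsAtom (ℓ i)
  label-atom i = proj₁ (proj₁ (labels i))

  pt-suc : ∀ i → pt (suc i) ≡ ℓ i ∨ pt (inject₁ i)
  pt-suc i = let (_ , ℓi≤pt , ℓi≰pt) , _ = labels i in ⋖⇒≡∨ (covers i) ℓi≤pt ℓi≰pt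

  pt-least : ∀ {X} i → (∀ j → j Fin.< i → ℓ j ≤ X) → pt i ≤ X
  pt-least {X} = <-weakInduction P base step
    where
    P : Fin (suc k) → Set
    P i = (∀ j → j Fin.< i → ℓ j ≤ X) → pt i ≤ X
    base : P zero
    base _ = subst (_≤ X) (sym bottom) (minimum X)
    step : ∀ i → P (inject₁ i) → P (suc i)
    step i IH h = subst (_≤ X) (sym (pt-suc i))
      (∨-least (h i ℕₚ.≤-refl) (IH λ j j<i →
        h j (ℕₚ.m≤n⇒m≤1+n (subst (toℕ j ℕ.<_) (Finₚ.toℕ-inject₁ i) j<i))))

  ⊤-least : ∀ {X} → (∀ j → ℓ j ≤ X) → ⊤ ≤ X
  ⊤-least {X} h = subst (_≤ X) top (pt-least (fromℕ k) (λ j _ → h j))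

module AscendingChain (L : FiniteLattice) (semimodular : FiniteLattice.Semimodular L)
  (key : FiniteLattice.Carrier L → ℕ) {r} (rank : FiniteLattice.HasRank L r)
  (c : FiniteLattice.MaximalChain L r) {ℓ : Fin r → FiniteLattice.Carrier L}
  (labels : FiniteLattice.HasLabels L key c ℓ)
  (increasing : FiniteLattice.WeaklyIncreasing L key ℓ) where
  open FiniteLattice L
  open MaximalChain c
  open Lattice L
  open Semimodularity L semimodular
  open LabelledChain L key c labels

  key-least : ∀ {b} i → IsAtom b → ¬ b ≤ pt (inject₁ i) → key (ℓ i) ℕ.≤ key b
  key-least {b} i b-atom b≰ = <-weakInduction P (λ _ _ ()) step (fromℕ r) b≤⊤ i i<r b≰
    where
    P : Fin (suc r) → Set
    P i = b ≤ pt i → ∀ j → j Fin.< i → ¬ b ≤ pt (inject₁ j) → key (ℓ j) ℕ.≤ key b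
    b≤⊤ : b ≤ pt (fromℕ r)
    b≤⊤ = subst (b ≤_) (sym top) (maximum b)
    i<r : i Fin.< fromℕ r
    i<r = subst (toℕ i ℕ.<_) (sym (Finₚ.toℕ-fromℕ r)) (Finₚ.toℕ<n i)
    step : ∀ i → P (inject₁ i) → P (suc i)
    step i IH b≤ j (s≤s j≤i) b≰j with b ≤? pt (inject₁ i)
    ... | no b≰i = ℕₚ.≤-trans (increasing j i j≤i) (proj₂ (labels i) b b-atom b≤ b≰i)
    ... | yes b≤i =
      IH b≤i j (subst (toℕ j ℕ.<_) (sym (Finₚ.toℕ-inject₁ i)) (ℕₚ.≤∧≢⇒< j≤i j≢i)) b≰j
      where
      j≢i : toℕ j ≢ toℕ i
      j≢i j≡i = b≰j (subst (λ t → b ≤ pt (inject₁ t)) (sym (Finₚ.toℕ-injective j≡i)) b≤i)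

  _≢?_ : ∀ (j m : Fin r) → Dec (j ≢ m)
  j ≢? m = ¬? (j Fin.≟ m)

  otherIndices : Fin r → List (Fin r)
  otherIndices m = filter (_≢? m) (allFin r)

  otherLabels : Fin r → List Carrier
  otherLabels m = map ℓ (otherIndices m)

  ≤⋁-otherLabels : ∀ {j m} → j ≢ m → ℓ j ≤ ⋁ (otherLabels m)
  ≤⋁-otherLabels {j} {m} j≢m = ⋁-upper (∈-map⁺ ℓ (∈-filter⁺ (_≢? m) (∈-allFin j) j≢m))

  length-otherLabels : ∀ m → length (otherLabels m) ℕ.< r
  length-otherLabels m =
    subst₂ ℕ._<_ (sym (Listₚ.length-map ℓ (otherIndices m))) (Listₚ.length-tabulate (λ j → j))
      (Listₚ.filter-notAll (_≢? m) (allFin r) (Any.map (λ m≡j m≢j → m≢j (sym m≡j)) (∈-allFin m)))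

  label-independent : ∀ m → ¬ ℓ m ≤ ⋁ (otherLabels m)
  label-independent m ℓm≤ = ℕₚ.<⇒≱ (length-otherLabels m)
    (rank≤length rank (map⁺ (universal label-atom (otherIndices m)))
      (≤-antisym (maximum _) (⊤-least ℓ≤)))
    where
    ℓ≤ : ∀ j → ℓ j ≤ ⋁ (otherLabels m)
    ℓ≤ j with j Fin.≟ m
    ... | yes refl = ℓm≤
    ... | no j≢m = ≤⋁-otherLabels j≢m

  isMinLabel-ℓ : ∀ {u v m} → u ⋖ v → ℓ m ≤ v → u ≤ ⋁ (otherLabels m) → IsMinLabel key u v (ℓ m)
  isMinLabel-ℓ {u} {v} {m} u⋖v ℓm≤v u≤others = (label-atom m , ℓm≤v , ℓm≰u) , minimal
    where
    ℓm≰u : ¬ ℓ m ≤ u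
    ℓm≰u ℓm≤u = label-independent m (≤-trans ℓm≤u u≤others)
    below-m : ∀ j → j Fin.< inject₁ m → ℓ j ≤ ⋁ (otherLabels m)
    below-m j j<m = ≤⋁-otherLabels λ { refl → ℕₚ.<⇒≢ j<m (sym (Finₚ.toℕ-inject₁ j)) }
    minimal : ∀ b → IsAtom b → b ≤ v → ¬ b ≤ u → key (ℓ m) ℕ.≤ key b
    minimal b b-atom b≤v b≰u with b ≤? pt (inject₁ m)
    ... | no b≰pt = key-least m b-atom b≰pt
    ... | yes b≤pt = contradiction (≤-trans ℓm≤v v≤others) (label-independent m)
      where
      v≤others : v ≤ ⋁ (otherLabels m)
      v≤others = subst (_≤ _) (sym (⋖⇒≡∨ u⋖v b≤v b≰u))
        (∨-least (≤-trans b≤pt (pt-least (inject₁ m) below-m)) u≤others)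

mainTheorem6 : (L : FiniteLattice) → FiniteLattice.Geometric L →
    (r : ℕ) → FiniteLattice.HasRank L r →
    (key : FiniteLattice.Carrier L → ℕ) → FiniteLattice.AtomOrder L key →
    (c : FiniteLattice.MaximalChain L r) → (ℓ : Fin r → FiniteLattice.Carrier L) →
    FiniteLattice.HasLabels L key c ℓ → FiniteLattice.WeaklyIncreasing L key ℓ →
    (σ : Permutation′ r) →
    Σ (FiniteLattice.MaximalChain L r) λ c′ →
    FiniteLattice.HasLabels L key c′ (λ i → ℓ (σ ⟨$⟩ʳ i))
mainTheorem6 L (_ , semimodular) r rank key _ c ℓ labels increasing σ =
  permutedChain , λ i → isMinLabel-ℓ (covers i) (⋁-upper (∈-prefix-suc g i)) (prefix≤otherLabels i)
  where
  open FiniteLattice L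
  open Lattice L
  open Semimodularity L semimodular
  open LabelledChain L key c labels using (label-atom; ⊤-least)
  open AscendingChain L semimodular key rank c labels increasing

  g : Fin r → Carrier
  g i = ℓ (σ ⟨$⟩ʳ i)

  σ-injective : ∀ {s t} → σ ⟨$⟩ʳ s ≡ σ ⟨$⟩ʳ t → s ≡ t
  σ-injective σs≡σt = trans (sym (inverseˡ σ)) (trans (cong (σ ⟨$⟩ˡ_) σs≡σt) (inverseˡ σ))

  prefix≤otherLabels : ∀ i → ⋁ (prefix g (inject₁ i)) ≤ ⋁ (otherLabels (σ ⟨$⟩ʳ i))
  prefix≤otherLabels i = ⋁-least (All-prefix g (inject₁ i) λ t t<i → ≤⋁-otherLabels λ σt≡σi →
    ℕₚ.<⇒≢ t<i (trans (cong toℕ (σ-injective σt≡σi)) (sym (Finₚ.toℕ-inject₁ i))))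

  spanning : ⋁ (prefix g (fromℕ r)) ≡ ⊤
  spanning = ≤-antisym (maximum _) (⊤-least λ j →
    subst (_≤ ⋁ (prefix g (fromℕ r))) (cong ℓ (inverseʳ σ)) (⋁-upper (∈-prefix-fromℕ g (σ ⟨$⟩ˡ j))))

  permutedChain : MaximalChain r
  permutedChain = prefixChain g (label-atom ∘ (σ ⟨$⟩ʳ_))
    (λ i gi≤ → label-independent _ (≤-trans gi≤ (prefix≤otherLabels i))) spanning

  open MaximalChain permutedChain using (covers)
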